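{- If $G$ is a connected graph of order $n \ge 3$, then $\alpha_1(G) \le n-1$, with equality if and only if $G \cong B^3_n$ or $G \cong U_{1,n-1}$.
   Context: All graphs are finite, simple and undirected. For $S \subseteq V(G)$, $\langle S\rangle_G$ denotes the induced subgraph. A $1$-nearly vertex independent set of $G$ is a set $S \subseteq V(G)$ such that $\langle S\rangle_G$ has exactly one edge, and $\alpha_1(G)$ is the maximum cardinality of such a set. The broom $B^3_n$ is the tree of order $n$ obtained from a path $P_3$ on three vertices by adding $n-3$ new vertices and joining each of them to exactly one (the same) end-vertex of $P_3$. The graph $U_{1,n-1}$ is obtained from the star $K_{1,n-1}$ by adding one edge between two of its leaves (so it is unicyclic, containing a triangle). -}

module Defs where

open import Data.Nat using (ℕ; zero; suc; _≤_)
open import Data.Bool using (Bool; true; false; _∨_)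
open import Data.Bool.Properties using (∨-comm)
open import Data.Fin using (Fin; toℕ)
open import Data.Fin.Subset using (Subset; _∈_; ∣_∣)
open import Data.Product using (Σ; _×_; _,_)
open import Data.Sum using (_⊎_)
open import Function.Bundles using (_↔_; Inverse)
open import Relation.Binary.PropositionalEquality using (_≡_; refl)

record Graph (n : ℕ) : Set where
  field
    adj    : Fin n → Fin n → Bool
    sym    : ∀ i j → adj i j ≡ adj j i
    irrefl : ∀ i → adj i i ≡ false
open Graph public

_~[_]_ : ∀ {n} → Fin n → Graph n → Fin n → Set
u ~[ G ] v = adj G u v ≡ true

data Reach {n : ℕ} (G : Graph n) : Fin n → Fin n → Set where
  here : ∀ {u} → Reach G u u
  step : ∀ {u w v} → u ~[ G ] w → Reach G w v → Reach G u v

Connected : ∀ {n} → Graph n → Set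
Connected {n} G = ∀ (u v : Fin n) → Reach G u v

_≅_ : ∀ {n} → Graph n → Graph n → Set
_≅_ {n} G H = Σ (Fin n ↔ Fin n) λ f →
  ∀ (i j : Fin n) → adj G i j ≡ adj H (Inverse.to f i) (Inverse.to f j)

NearlyIndep₁ : ∀ {n} → Graph n → Subset n → Set
NearlyIndep₁ {n} G S = Σ (Fin n) λ u → Σ (Fin n) λ v →
  u ∈ S × v ∈ S × u ~[ G ] v ×
  (∀ (x y : Fin n) → x ∈ S → y ∈ S → x ~[ G ] y →
     (x ≡ u × y ≡ v) ⊎ (x ≡ v × y ≡ u))

IsAlpha₁ : ∀ {n} → Graph n → ℕ → Set
IsAlpha₁ {n} G k =
  (Σ (Subset n) λ S → NearlyIndep₁ G S × ∣ S ∣ ≡ k) ×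
  (∀ (S : Subset n) → NearlyIndep₁ G S → ∣ S ∣ ≤ k)

module _ where
  private
    symm : (ℕ → ℕ → Bool) → ℕ → ℕ → Bool
    symm e a b = e a b ∨ e b a

  -- Broom B³ₙ: path 0 - 1 - 2 with end-vertex 0,
  -- and every vertex k ≥ 3 joined to the end-vertex 0.
  broomE : ℕ → ℕ → Bool
  broomE 0 1 = true
  broomE 1 2 = true
  broomE 0 (suc (suc (suc _))) = true
  broomE _ _ = false

  broomE-irr : ∀ a → broomE a a ≡ false
  broomE-irr 0 = refl
  broomE-irr 1 = refl
  broomE-irr (suc (suc _)) = refl

  Broom3 : (n : ℕ) → Graph n
  Broom3 n = record
    { adj    = λ i j → symm broomE (toℕ i) (toℕ j)
    ; sym    = λ i j → ∨-comm (broomE (toℕ i) (toℕ j)) (broomE (toℕ j) (toℕ i))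
    ; irrefl = λ i → irr (toℕ i) }
    where
    irr : ∀ a → symm broomE a a ≡ false
    irr a rewrite broomE-irr a = refl

  -- U_{1,n-1}: star with centre 0 joined to every other vertex, plus the edge {1,2}.
  unicE : ℕ → ℕ → Bool
  unicE 0 (suc _) = true
  unicE 1 2 = true
  unicE _ _ = false

  unicE-irr : ∀ a → unicE a a ≡ false
  unicE-irr 0 = refl
  unicE-irr 1 = refl
  unicE-irr (suc (suc _)) = refl

  U1 : (n : ℕ) → Graph n
  U1 n = record
    { adj    = λ i j → symm unicE (toℕ i) (toℕ j)
    ; sym    = λ i j → ∨-comm (unicE (toℕ i) (toℕ j)) (unicE (toℕ j) (toℕ i))
    ; irrefl = λ i → irr (toℕ i) }
    where
    irr : ∀ a → symm unicE a a ≡ false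
    irr a rewrite unicE-irr a = refl

{-# OPTIONS --safe #-}

-- A 1-nearly independent set S with edge uv cannot contain every vertex: a third vertex
-- has a neighbour, giving a second edge inside S.  Hence α₁ ≤ n − 1, with equality iff
-- for some vertex w the graph G − w has uv as its only edge.  By connectivity w is then
-- adjacent to every vertex other than u and v, and to at least one of them; as all other
-- adjacencies are forced, relabelling w, u, v as 0, 1, 2 identifies G with U_{1,n-1} if w
-- is adjacent to both and with B³ₙ otherwise.  Conversely, deleting vertex 0 from either
-- model leaves the single edge {1,2}.
module Submission where

open import Defs
open import Data.Nat using (ℕ; zero; suc; _≤_; _∸_; _+_; z≤n; s≤s)
import Data.Nat as ℕ
open import Data.Nat.Properties using (≤-antisym; ≤-pred; ≤∧≢⇒<; n≤0⇒n≡0; suc-injective; m+n∸n≡m)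
open import Data.Bool using (true)
import Data.Bool as Bool
open import Data.Bool.Properties using (⇔→≡)
open import Data.Empty using (⊥-elim)
open import Data.Fin using (Fin; zero; suc; _≟_)
open import Data.Fin.Properties using (any?; all?)
open import Data.Fin.Subset using (Subset; inside; outside; _∈_; _∉_; ∣_∣; ⁅_⁆; ∁; _∪_; ⊥; ⊤)
open import Data.Fin.Subset.Properties
  using ( _∈?_; anySubset?; ∈⊤; ∣p∣≤n; ∣p∣≡n⇒p≡⊤; ∣⁅x⁆∣≡1; ∣∁p∣≡n∸∣p∣; x∈⁅x⁆; x∈⁅y⁆⇒x≡y
        ; x≢y⇒x∉⁅y⁆; x∉⁅y⁆⇒x≢y; x∈p⇒x∉∁p; x∈∁p⇒x∉p; x∉∁p⇒x∈p; x∉p⇒x∈∁p; x∈p∪q⁺; x∈p∪q⁻)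
open import Data.Fin.Permutation using (Permutation′; id; transpose; _∘ₚ_; _⟨$⟩ʳ_; _⟨$⟩ˡ_; inverseʳ)
import Data.Fin.Permutation.Components as PC
open import Data.Vec using (_∷_; [])
open import Data.Product using (Σ; ∃; ∃₂; _×_; _,_; proj₁; proj₂)
import Data.Product as Product
open import Data.Sum using (_⊎_; inj₁; inj₂; [_,_]′)
import Data.Sum as Sum
open import Function using (_∘_; const)
open import Function.Bundles using (_⇔_; mk⇔; Equivalence; Injection)
open import Function.Properties.Inverse using (Inverse⇒Injection)
import Function.Properties.Equivalence as ⇔
open import Relation.Nullary using (Dec; yes; no; ¬_)
open import Relation.Nullary.Decidable using (_×-dec_; _⊎-dec_; _→-dec_; dec-true; dec-false)
open import Relation.Binary.PropositionalEquality as ≡ using (_≡_; _≢_; refl; cong; subst; ≢-sym)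

private
  variable
    n m k : ℕ
    G H : Graph n
    S : Subset n
    a b c u v w x y z u′ v′ w′ x₀ x₁ x₂ y₀ y₁ y₂ : Fin n

∣p∣≡0⇒p≡⊥ : (p : Subset n) → ∣ p ∣ ≡ 0 → p ≡ ⊥
∣p∣≡0⇒p≡⊥ []            _ = refl
∣p∣≡0⇒p≡⊥ (outside ∷ p) h = cong (outside ∷_) (∣p∣≡0⇒p≡⊥ p h)

∣p∣≡1⇒p≡⁅x⁆ : (p : Subset n) → ∣ p ∣ ≡ 1 → ∃ λ x → p ≡ ⁅ x ⁆
∣p∣≡1⇒p≡⁅x⁆ (inside  ∷ p) h = zero , cong (inside ∷_) (∣p∣≡0⇒p≡⊥ p (suc-injective h))
∣p∣≡1⇒p≡⁅x⁆ (outside ∷ p) h = Product.map suc (cong (outside ∷_)) (∣p∣≡1⇒p≡⁅x⁆ p h)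

x∈∁⁅y⁆⇔x≢y : x ∈ ∁ ⁅ y ⁆ ⇔ x ≢ y
x∈∁⁅y⁆⇔x≢y = mk⇔ (x∉⁅y⁆⇒x≢y ∘ x∈∁p⇒x∉p) (x∉p⇒x∈∁p ∘ x≢y⇒x∉⁅y⁆)

∣∁⁅x⁆∣≡n : (x : Fin (suc n)) → ∣ ∁ ⁅ x ⁆ ∣ ≡ n
∣∁⁅x⁆∣≡n {n} x = ≡.trans (∣∁p∣≡n∸∣p∣ ⁅ x ⁆) (cong (suc n ∸_) (∣⁅x⁆∣≡1 x))

∣p∣≡n⇒p≗∁⁅x⁆ : (p : Subset (suc n)) → ∣ p ∣ ≡ n → ∃ λ x → ∀ {y} → y ∈ p ⇔ y ≢ x
∣p∣≡n⇒p≗∁⁅x⁆ {n} p ∣p∣≡n =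
  let x , ∁p≡⁅x⁆ = ∣p∣≡1⇒p≡⁅x⁆ (∁ p) ∣∁p∣≡1
  in  x , mk⇔ (x∉⁅y⁆⇒x≢y ∘ subst (_ ∉_) ∁p≡⁅x⁆ ∘ x∈p⇒x∉∁p)
              (x∉∁p⇒x∈p ∘ subst (_ ∉_) (≡.sym ∁p≡⁅x⁆) ∘ x≢y⇒x∉⁅y⁆)
  where
  ∣∁p∣≡1 : ∣ ∁ p ∣ ≡ 1
  ∣∁p∣≡1 = ≡.trans (∣∁p∣≡n∸∣p∣ p) (≡.trans (cong (suc n ∸_) ∣p∣≡n) (m+n∸n≡m 1 n))

greatest : {P : ℕ → Set} → (∀ k → Dec (P k)) →
           ∀ m → (∀ {j} → P j → j ≤ m) → P k → ∃ λ j → P j × (∀ {i} → P i → i ≤ j)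
greatest P? m bounded pk with P? m
... | yes pm = m , pm , bounded
greatest {P = P} P? zero bounded pk | no ¬pm = ⊥-elim (¬pm (subst P (n≤0⇒n≡0 (bounded pk)) pk))
greatest P? (suc m) bounded pk | no ¬pm =
  greatest P? m (λ pj → ≤-pred (≤∧≢⇒< (bounded pj) λ { refl → ¬pm pj })) pk

transpose-sends : (i j : Fin n) → PC.transpose i j i ≡ j
transpose-sends i j rewrite dec-true (i ≟ i) refl = refl

transpose-fixes : z ≢ x → z ≢ y → PC.transpose x y z ≡ z
transpose-fixes {z = z} {x = x} {y = y} z≢x z≢y
  rewrite dec-false (z ≟ x) z≢x | dec-false (z ≟ y) z≢y = refl

retarget : Permutation′ n → Fin n → Fin n → Permutation′ n
retarget π x y = π ∘ₚ transpose (π ⟨$⟩ʳ x) y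

retarget-sends : (π : Permutation′ n) (x y : Fin n) → retarget π x y ⟨$⟩ʳ x ≡ y
retarget-sends π x y = transpose-sends (π ⟨$⟩ʳ x) y

retarget-keeps : (π : Permutation′ n) → z ≢ x → π ⟨$⟩ʳ z ≡ y₀ → y₀ ≢ y → retarget π x y ⟨$⟩ʳ z ≡ y₀
retarget-keeps π z≢x refl y₀≢y = transpose-fixes (z≢x ∘ injective) y₀≢y
  where open Injection (Inverse⇒Injection π) using (injective)

Distinct₃ : Fin n → Fin n → Fin n → Set
Distinct₃ x₀ x₁ x₂ = x₀ ≢ x₁ × x₀ ≢ x₂ × x₁ ≢ x₂

place₃ : Distinct₃ x₀ x₁ x₂ → Distinct₃ y₀ y₁ y₂ →
         ∃ λ (π : Permutation′ n) → π ⟨$⟩ʳ x₀ ≡ y₀ × π ⟨$⟩ʳ x₁ ≡ y₁ × π ⟨$⟩ʳ x₂ ≡ y₂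
place₃ {x₀ = x₀} {x₁} {x₂} {y₀ = y₀} {y₁} {y₂} (x₀≢x₁ , x₀≢x₂ , x₁≢x₂) (y₀≢y₁ , y₀≢y₂ , y₁≢y₂) =
  π₃ , π₃x₀ , π₃x₁ , retarget-sends π₂ x₂ y₂
  where
  π₁ π₂ π₃ : Permutation′ _
  π₁ = retarget id x₀ y₀
  π₂ = retarget π₁ x₁ y₁
  π₃ = retarget π₂ x₂ y₂
  π₂x₀ : π₂ ⟨$⟩ʳ x₀ ≡ y₀
  π₂x₀ = retarget-keeps π₁ x₀≢x₁ (retarget-sends id x₀ y₀) y₀≢y₁
  π₃x₀ : π₃ ⟨$⟩ʳ x₀ ≡ y₀
  π₃x₀ = retarget-keeps π₂ x₀≢x₂ π₂x₀ y₀≢y₂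
  π₃x₁ : π₃ ⟨$⟩ʳ x₁ ≡ y₁
  π₃x₁ = retarget-keeps π₂ x₁≢x₂ (retarget-sends π₁ x₁ y₁) y₁≢y₂

~-sym : (G : Graph n) → x ~[ G ] y → y ~[ G ] x
~-sym {x = x} {y = y} G x~y = ≡.trans (sym G y x) x~y

~-sym-⇔ : (G : Graph n) → x ~[ G ] y ⇔ y ~[ G ] x
~-sym-⇔ G = mk⇔ (~-sym G) (~-sym G)

~-irrefl : (G : Graph n) → x ~[ G ] y → x ≢ y
~-irrefl {x = x} G x~x refl with ≡.trans (≡.sym x~x) (irrefl G x)
... | ()

reach-neighbour : Reach G x y → x ≢ y → ∃ λ z → x ~[ G ] z
reach-neighbour here        x≢x = ⊥-elim (x≢x refl)
reach-neighbour (step x~z _) _  = _ , x~z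

SameEdge : Fin n → Fin n → Fin n → Fin n → Set
SameEdge x y u v = (x ≡ u × y ≡ v) ⊎ (x ≡ v × y ≡ u)

SameEdge-cong : (f : Fin n → Fin m) → SameEdge x y u v → SameEdge (f x) (f y) (f u) (f v)
SameEdge-cong f = Sum.map (Product.map (cong f) (cong f)) (Product.map (cong f) (cong f))

SameEdge-injective : {f : Fin n → Fin m} → (∀ {a b} → f a ≡ f b → a ≡ b) →
                     SameEdge (f x) (f y) (f u) (f v) → SameEdge x y u v
SameEdge-injective inj = Sum.map (Product.map inj inj) (Product.map inj inj)

SameEdge⇒~ : (G : Graph n) → u ~[ G ] v → SameEdge x y u v → x ~[ G ] y
SameEdge⇒~ G u~v (inj₁ (refl , refl)) = u~v
SameEdge⇒~ G u~v (inj₂ (refl , refl)) = ~-sym G u~v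

nearlyIndep₁? : (G : Graph n) (S : Subset n) → Dec (NearlyIndep₁ G S)
nearlyIndep₁? G S =
  any? λ u → any? λ v → u ∈? S ×-dec v ∈? S ×-dec adj? u v ×-dec
    all? λ x → all? λ y → x ∈? S →-dec y ∈? S →-dec adj? x y →-dec
      ((x ≟ u ×-dec y ≟ v) ⊎-dec (x ≟ v ×-dec y ≟ u))
  where
  adj? : ∀ x y → Dec (x ~[ G ] y)
  adj? x y = adj G x y Bool.≟ true

edge-nearlyIndep₁ : (G : Graph n) → u ~[ G ] v → NearlyIndep₁ G (⁅ u ⁆ ∪ ⁅ v ⁆)
edge-nearlyIndep₁ {u = u} {v = v} G u~v =
  u , v , x∈p∪q⁺ (inj₁ (x∈⁅x⁆ u)) , x∈p∪q⁺ (inj₂ (x∈⁅x⁆ v)) , u~v , only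
  where
  endpoint : x ∈ ⁅ u ⁆ ∪ ⁅ v ⁆ → x ≡ u ⊎ x ≡ v
  endpoint = Sum.map (x∈⁅y⁆⇒x≡y u) (x∈⁅y⁆⇒x≡y v) ∘ x∈p∪q⁻ ⁅ u ⁆ ⁅ v ⁆
  only : ∀ x y → x ∈ ⁅ u ⁆ ∪ ⁅ v ⁆ → y ∈ ⁅ u ⁆ ∪ ⁅ v ⁆ → x ~[ G ] y → SameEdge x y u v
  only x y x∈ y∈ x~y with endpoint x∈ | endpoint y∈
  ... | inj₁ refl | inj₁ refl = ⊥-elim (~-irrefl G x~y refl)
  ... | inj₁ refl | inj₂ refl = inj₁ (refl , refl)
  ... | inj₂ refl | inj₁ refl = inj₂ (refl , refl)
  ... | inj₂ refl | inj₂ refl = ⊥-elim (~-irrefl G x~y refl)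

isAlpha₁-exists : (G : Graph n) → NearlyIndep₁ G S → ∃ (IsAlpha₁ G)
isAlpha₁-exists {n} {S} G ni =
  let k , largest , maximal = greatest P? n bounded (S , ni , refl)
  in  k , largest , λ T niT → maximal (T , niT , refl)
  where
  P : ℕ → Set
  P k = ∃ λ T → NearlyIndep₁ G T × ∣ T ∣ ≡ k
  P? : ∀ k → Dec (P k)
  P? k = anySubset? λ T → nearlyIndep₁? G T ×-dec ∣ T ∣ ℕ.≟ k
  bounded : ∀ {k} → P k → k ≤ n
  bounded (T , _ , refl) = ∣p∣≤n T

connected⇒isAlpha₁ : {G : Graph (2 + m)} → Connected G → ∃ (IsAlpha₁ G)
connected⇒isAlpha₁ {G = G} conn =
  isAlpha₁-exists G (edge-nearlyIndep₁ G (proj₂ (reach-neighbour (conn zero (suc zero)) (λ ()))))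

avoid₂ : (u v : Fin (3 + m)) → ∃ λ w → w ≢ u × w ≢ v
avoid₂ zero          zero          = suc zero       , (λ ()) , (λ ())
avoid₂ zero          (suc zero)    = suc (suc zero) , (λ ()) , (λ ())
avoid₂ zero          (suc (suc _)) = suc zero       , (λ ()) , (λ ())
avoid₂ (suc zero)    zero          = suc (suc zero) , (λ ()) , (λ ())
avoid₂ (suc (suc _)) zero          = suc zero       , (λ ()) , (λ ())
avoid₂ (suc _)       (suc _)       = zero           , (λ ()) , (λ ())

¬nearlyIndep₁-⊤ : {G : Graph (3 + m)} → Connected G → ¬ NearlyIndep₁ G ⊤
¬nearlyIndep₁-⊤ conn (u , v , _ , _ , _ , only) with avoid₂ u v
... | w , w≢u , w≢v with reach-neighbour (conn w u) w≢u
...   | c , w~c = [ w≢u ∘ proj₁ , w≢v ∘ proj₁ ]′ (only w c ∈⊤ ∈⊤ w~c)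

isAlpha₁-≤ : {G : Graph (3 + m)} → Connected G → IsAlpha₁ G k → k ≤ 2 + m
isAlpha₁-≤ {G = G} conn ((S , ni , refl) , _) =
  ≤-pred (≤∧≢⇒< (∣p∣≤n S) λ ∣S∣≡n →
    ¬nearlyIndep₁-⊤ conn (subst (NearlyIndep₁ G) (∣p∣≡n⇒p≡⊤ ∣S∣≡n) ni))

record OnlyEdgeOff (G : Graph n) (w u v : Fin n) : Set where
  field
    u≢w  : u ≢ w
    v≢w  : v ≢ w
    u~v  : u ~[ G ] v
    only : ∀ {x y} → x ≢ w → y ≢ w → x ~[ G ] y → SameEdge x y u v

open OnlyEdgeOff

nearlyIndep₁⇔onlyEdgeOff : (∀ {y} → y ∈ S ⇔ y ≢ w) → NearlyIndep₁ G S ⇔ ∃₂ (OnlyEdgeOff G w)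
nearlyIndep₁⇔onlyEdgeOff {S = S} {w = w} ∈S⇔≢w = mk⇔
  (λ (u , v , u∈S , v∈S , u~v , only) → u , v , record
     { u≢w = to u∈S ; v≢w = to v∈S ; u~v = u~v
     ; only = λ x≢w y≢w → only _ _ (from x≢w) (from y≢w) })
  (λ (u , v , e) → u , v , from (u≢w e) , from (v≢w e) , u~v e ,
     λ x y x∈S y∈S → only e (to x∈S) (to y∈S))
  where
  to : y ∈ S → y ≢ w
  to = Equivalence.to ∈S⇔≢w
  from : y ≢ w → y ∈ S
  from = Equivalence.from ∈S⇔≢w

onlyEdgeOff-swap : OnlyEdgeOff G w u v → OnlyEdgeOff G w v u
onlyEdgeOff-swap {G = G} e = record
  { u≢w = v≢w e ; v≢w = u≢w e ; u~v = ~-sym G (u~v e)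
  ; only = λ x≢w y≢w → Sum.swap ∘ only e x≢w y≢w }

onlyEdgeOff-distinct : OnlyEdgeOff G w u v → Distinct₃ w u v
onlyEdgeOff-distinct {G = G} e = ≢-sym (u≢w e) , ≢-sym (v≢w e) , ~-irrefl G (u~v e)

onlyEdgeOff-≅ : ((π , _) : G ≅ H) → OnlyEdgeOff H w u v →
                OnlyEdgeOff G (π ⟨$⟩ˡ w) (π ⟨$⟩ˡ u) (π ⟨$⟩ˡ v)
onlyEdgeOff-≅ {G = G} {H = H} (π , pres) = pull (inverseʳ π) (inverseʳ π) (inverseʳ π)
  where
  open Injection (Inverse⇒Injection π) using (injective)
  pull : π ⟨$⟩ʳ a ≡ w → π ⟨$⟩ʳ b ≡ u → π ⟨$⟩ʳ c ≡ v → OnlyEdgeOff H w u v → OnlyEdgeOff G a b c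
  pull refl refl refl e = record
    { u≢w  = u≢w e ∘ cong (π ⟨$⟩ʳ_)
    ; v≢w  = v≢w e ∘ cong (π ⟨$⟩ʳ_)
    ; u~v  = ≡.trans (pres _ _) (u~v e)
    ; only = λ x≢w y≢w x~y → SameEdge-injective injective
               (only e (x≢w ∘ injective) (y≢w ∘ injective) (≡.trans (≡.sym (pres _ _)) x~y)) }

module _ {G : Graph n} (conn : Connected G) (e : OnlyEdgeOff G w u v) where

  onlyEdgeOff-dominates : x ≢ w → x ≢ u → x ≢ v → w ~[ G ] x
  onlyEdgeOff-dominates {x = x} x≢w x≢u x≢v with reach-neighbour (conn x u) x≢u
  ... | c , x~c with c ≟ w
  ...   | yes refl = ~-sym G x~c
  ...   | no c≢w   = ⊥-elim ([ x≢u ∘ proj₁ , x≢v ∘ proj₁ ]′ (only e x≢w c≢w x~c))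

  onlyEdgeOff-adjacent : w ~[ G ] u ⊎ w ~[ G ] v
  onlyEdgeOff-adjacent = escape (conn u w) (inj₁ refl)
    where
    endpoint≢w : x ≡ u ⊎ x ≡ v → x ≢ w
    endpoint≢w = [ (λ { refl → u≢w e }) , (λ { refl → v≢w e }) ]′
    escape : Reach G x w → x ≡ u ⊎ x ≡ v → w ~[ G ] u ⊎ w ~[ G ] v
    escape here x∈uv = ⊥-elim (endpoint≢w x∈uv refl)
    escape (step {w = c} x~c walk) x∈uv with c ≟ w
    ... | yes refl = Sum.map (λ { refl → ~-sym G x~c }) (λ { refl → ~-sym G x~c }) x∈uv
    ... | no c≢w   = escape walk (Sum.swap (Sum.map proj₂ proj₂ (only e (endpoint≢w x∈uv) c≢w x~c)))

record Hub (G : Graph n) (w u v : Fin n) : Set where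
  field
    onlyEdgeOff : OnlyEdgeOff G w u v
    dominates   : ∀ {x} → x ≢ w → x ≢ u → x ≢ v → w ~[ G ] x

open Hub

connected⇒hub : Connected G → OnlyEdgeOff G w u v → Hub G w u v
connected⇒hub conn e = record { onlyEdgeOff = e ; dominates = onlyEdgeOff-dominates conn e }

hub-≅-via : (π : Permutation′ n) → Hub G w u v → Hub H w′ u′ v′ →
            π ⟨$⟩ʳ w ≡ w′ → π ⟨$⟩ʳ u ≡ u′ → π ⟨$⟩ʳ v ≡ v′ →
            (w ~[ G ] u ⇔ w′ ~[ H ] u′) → (w ~[ G ] v ⇔ w′ ~[ H ] v′) → G ≅ H
hub-≅-via {G = G} {w = w} {u = u} {v = v} {H = H} π hG hH refl refl refl w~u⇔ w~v⇔ =
  π , λ i j → ⇔→≡ (~⇔~ i j)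
  where
  f : Fin _ → Fin _
  f = π ⟨$⟩ʳ_
  open Injection (Inverse⇒Injection π) using (injective)

  hub-~⇔ : ∀ x → w ~[ G ] x ⇔ f w ~[ H ] f x
  hub-~⇔ x with x ≟ w | x ≟ u | x ≟ v
  ... | yes refl | _        | _        = mk⇔ (λ w~w → ⊥-elim (~-irrefl G w~w refl))
                                           (λ fw~fw → ⊥-elim (~-irrefl H fw~fw refl))
  ... | no _     | yes refl | _        = w~u⇔
  ... | no _     | no _     | yes refl = w~v⇔
  ... | no x≢w   | no x≢u   | no x≢v   = mk⇔
    (const (dominates hH (x≢w ∘ injective) (x≢u ∘ injective) (x≢v ∘ injective)))
    (const (dominates hG x≢w x≢u x≢v))

  ~⇔~ : ∀ i j → i ~[ G ] j ⇔ f i ~[ H ] f j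
  ~⇔~ i j with i ≟ w | j ≟ w
  ... | yes refl | _        = hub-~⇔ j
  ... | no _     | yes refl = ⇔.trans (~-sym-⇔ G) (⇔.trans (hub-~⇔ i) (~-sym-⇔ H))
  ... | no i≢w   | no j≢w   = mk⇔
    (SameEdge⇒~ H (u~v (onlyEdgeOff hH)) ∘ SameEdge-cong f ∘ only (onlyEdgeOff hG) i≢w j≢w)
    (SameEdge⇒~ G (u~v (onlyEdgeOff hG)) ∘ SameEdge-injective injective
      ∘ only (onlyEdgeOff hH) (i≢w ∘ injective) (j≢w ∘ injective))

hub-≅ : Hub G w u v → Hub H w′ u′ v′ →
        (w ~[ G ] u ⇔ w′ ~[ H ] u′) → (w ~[ G ] v ⇔ w′ ~[ H ] v′) → G ≅ H
hub-≅ hG hH =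
  let π , πw , πu , πv = place₃ (onlyEdgeOff-distinct (onlyEdgeOff hG))
                                (onlyEdgeOff-distinct (onlyEdgeOff hH))
  in  hub-≅-via π hG hH πw πu πv

module _ {m : ℕ} where

  private
    N : ℕ
    N = 3 + m

  broom-only : ∀ {x y : Fin N} → x ≢ zero → y ≢ zero → x ~[ Broom3 N ] y →
               SameEdge x y (suc zero) (suc (suc zero))
  broom-only {zero}                              x≢0 _   _ = ⊥-elim (x≢0 refl)
  broom-only {y = zero}                          _   y≢0 _ = ⊥-elim (y≢0 refl)
  broom-only {suc zero}          {suc (suc zero)}    _ _ _ = inj₁ (refl , refl)
  broom-only {suc (suc zero)}    {suc zero}          _ _ _ = inj₂ (refl , refl)
  broom-only {suc zero}          {suc zero}          _ _ ()
  broom-only {suc zero}          {suc (suc (suc _))} _ _ ()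
  broom-only {suc (suc zero)}    {suc (suc zero)}    _ _ ()
  broom-only {suc (suc zero)}    {suc (suc (suc _))} _ _ ()
  broom-only {suc (suc (suc _))} {suc zero}          _ _ ()
  broom-only {suc (suc (suc _))} {suc (suc zero)}    _ _ ()
  broom-only {suc (suc (suc _))} {suc (suc (suc _))} _ _ ()

  broom-dominates : ∀ {x : Fin N} → x ≢ zero → x ≢ suc zero → x ≢ suc (suc zero) →
                   zero ~[ Broom3 N ] x
  broom-dominates {zero}              x≢0 _   _   = ⊥-elim (x≢0 refl)
  broom-dominates {suc zero}          _   x≢1 _   = ⊥-elim (x≢1 refl)
  broom-dominates {suc (suc zero)}    _   _   x≢2 = ⊥-elim (x≢2 refl)
  broom-dominates {suc (suc (suc _))} _   _   _   = refl

  broom-hub : Hub (Broom3 N) zero (suc zero) (suc (suc zero))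
  broom-hub = record
    { onlyEdgeOff = record { u≢w = λ () ; v≢w = λ () ; u~v = refl ; only = broom-only }
    ; dominates   = broom-dominates }

  U1-only : ∀ {x y : Fin N} → x ≢ zero → y ≢ zero → x ~[ U1 N ] y →
            SameEdge x y (suc zero) (suc (suc zero))
  U1-only {zero}                              x≢0 _   _ = ⊥-elim (x≢0 refl)
  U1-only {y = zero}                          _   y≢0 _ = ⊥-elim (y≢0 refl)
  U1-only {suc zero}          {suc (suc zero)}    _ _ _ = inj₁ (refl , refl)
  U1-only {suc (suc zero)}    {suc zero}          _ _ _ = inj₂ (refl , refl)
  U1-only {suc zero}          {suc zero}          _ _ ()
  U1-only {suc zero}          {suc (suc (suc _))} _ _ ()
  U1-only {suc (suc zero)}    {suc (suc zero)}    _ _ ()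
  U1-only {suc (suc zero)}    {suc (suc (suc _))} _ _ ()
  U1-only {suc (suc (suc _))} {suc zero}          _ _ ()
  U1-only {suc (suc (suc _))} {suc (suc zero)}    _ _ ()
  U1-only {suc (suc (suc _))} {suc (suc (suc _))} _ _ ()

  U1-dominates : ∀ {x : Fin N} → x ≢ zero → x ≢ suc zero → x ≢ suc (suc zero) →
                zero ~[ U1 N ] x
  U1-dominates {zero}              x≢0 _   _   = ⊥-elim (x≢0 refl)
  U1-dominates {suc zero}          _   x≢1 _   = ⊥-elim (x≢1 refl)
  U1-dominates {suc (suc zero)}    _   _   x≢2 = ⊥-elim (x≢2 refl)
  U1-dominates {suc (suc (suc _))} _   _   _   = refl

  U1-hub : Hub (U1 N) zero (suc zero) (suc (suc zero))
  U1-hub = record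
    { onlyEdgeOff = record { u≢w = λ () ; v≢w = λ () ; u~v = refl ; only = U1-only }
    ; dominates   = U1-dominates }

hub⇒models : {G : Graph (3 + m)} → Hub G w u v → w ~[ G ] u → G ≅ Broom3 (3 + m) ⊎ G ≅ U1 (3 + m)
hub⇒models {w = w} {v = v} {G = G} h w~u with adj G w v Bool.≟ true
... | yes w~v = inj₂ (hub-≅ h U1-hub (mk⇔ (const refl) (const w~u))
                                     (mk⇔ (const refl) (const w~v)))
... | no ¬w~v = inj₁ (hub-≅ h broom-hub (mk⇔ (const refl) (const w~u))
                                        (mk⇔ (⊥-elim ∘ ¬w~v) λ ()))

onlyEdgeOff⇔models : {G : Graph (3 + m)} → Connected G →
                     (∃ λ w → ∃₂ (OnlyEdgeOff G w)) ⇔ (G ≅ Broom3 (3 + m) ⊎ G ≅ U1 (3 + m))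
onlyEdgeOff⇔models {G = G} conn = mk⇔ classify realise
  where
  classify : (∃ λ w → ∃₂ (OnlyEdgeOff G w)) → G ≅ Broom3 _ ⊎ G ≅ U1 _
  classify (w , u , v , e) with onlyEdgeOff-adjacent conn e
  ... | inj₁ w~u = hub⇒models (connected⇒hub conn e) w~u
  ... | inj₂ w~v = hub⇒models (connected⇒hub conn (onlyEdgeOff-swap e)) w~v
  realise : G ≅ Broom3 _ ⊎ G ≅ U1 _ → ∃ λ w → ∃₂ (OnlyEdgeOff G w)
  realise (inj₁ G≅B) = _ , _ , _ , onlyEdgeOff-≅ G≅B (onlyEdgeOff broom-hub)
  realise (inj₂ G≅U) = _ , _ , _ , onlyEdgeOff-≅ G≅U (onlyEdgeOff U1-hub)

isAlpha₁≡n⇔onlyEdgeOff : {G : Graph (suc n)} → IsAlpha₁ G k → k ≤ n →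
                         (k ≡ n ⇔ ∃ λ w → ∃₂ (OnlyEdgeOff G w))
isAlpha₁≡n⇔onlyEdgeOff {n = n} {k = k} {G = G} ((S , ni , ∣S∣≡k) , maximal) k≤n =
  mk⇔ attained reached
  where
  attained : k ≡ n → ∃ λ w → ∃₂ (OnlyEdgeOff G w)
  attained refl with ∣p∣≡n⇒p≗∁⁅x⁆ S ∣S∣≡k
  ... | w , ∈S⇔≢w = w , Equivalence.to (nearlyIndep₁⇔onlyEdgeOff ∈S⇔≢w) ni
  reached : (∃ λ w → ∃₂ (OnlyEdgeOff G w)) → k ≡ n
  reached (w , e) = ≤-antisym k≤n (subst (_≤ k) (∣∁⁅x⁆∣≡n w)
    (maximal _ (Equivalence.from (nearlyIndep₁⇔onlyEdgeOff x∈∁⁅y⁆⇔x≢y) e)))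

theorem5 : (n : ℕ) → (G : Graph n) → 3 ≤ n → Connected G →
    Σ ℕ λ k → IsAlpha₁ G k × k ≤ n ∸ 1 ×
      (k ≡ n ∸ 1 ⇔ (G ≅ Broom3 n ⊎ G ≅ U1 n))
theorem5 (suc (suc (suc m))) G (s≤s (s≤s (s≤s z≤n))) conn =
  let k , α = connected⇒isAlpha₁ conn
      k≤n∸1 = isAlpha₁-≤ conn α
  in  k , α , k≤n∸1 , ⇔.trans (isAlpha₁≡n⇔onlyEdgeOff α k≤n∸1) (onlyEdgeOff⇔models conn)
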